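{- Let $G$ be a connected graph of order $n\geq 3$ that is not complete. If $D$ is a minimum connected dominating set of $G$ or a minimum weakly convex dominating set of $G$, then every cut-vertex of $G$ belongs to $D$ and no simplicial vertex of $G$ belongs to $D$.
   Context: Graphs are finite, simple, undirected, connected. A vertex $v$ is simplicial if its closed neighbourhood $N_G[v]$ induces a complete graph. A cut-vertex is a vertex whose removal increases the number of components. A set $D$ is dominating if every vertex outside $D$ has a neighbour in $D$; it is a connected dominating set if also $G[D]$ is connected; it is weakly convex if for any $a,b\in D$ some shortest $(a-b)$-path in $G$ has all its vertices in $D$. "Minimum" means of minimum cardinality among sets of that type. -}

module Defs where

open import Data.Nat using (ℕ; zero; suc; _≤_)
open import Data.Fin using (Fin)
open import Data.Fin.Subset using (Subset; _∈_; _∉_; ∣_∣)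
open import Data.Product using (Σ; ∃; _×_; _,_)
open import Data.Sum using (_⊎_)
open import Data.Unit using (⊤)
open import Relation.Nullary using (¬_)
open import Relation.Binary.PropositionalEquality using (_≡_; _≢_)

record Graph (n : ℕ) : Set₁ where
  field
    Adj     : Fin n → Fin n → Set
    sym     : ∀ {u v} → Adj u v → Adj v u
    irrefl  : ∀ {u} → ¬ Adj u u
open Graph public

module _ {n : ℕ} (G : Graph n) where

  -- Walk P u v k : a walk of length k (k edges) from u to v in G,
  -- all of whose vertices satisfy P.
  data Walk (P : Fin n → Set) : Fin n → Fin n → ℕ → Set where
    [_]  : ∀ {u} → P u → Walk P u u 0
    _∷⟨_⟩_ : ∀ {u w v k} → P u → Adj G u w → Walk P w v k → Walk P u v (suc k)

  AnyVertex : Fin n → Set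
  AnyVertex _ = ⊤

  Connected : Set
  Connected = ∀ u v → ∃ λ k → Walk AnyVertex u v k

  Complete : Set
  Complete = ∀ u v → u ≢ v → Adj G u v

  InClosedNbhd : Fin n → Fin n → Set
  InClosedNbhd v x = x ≡ v ⊎ Adj G v x

  Simplicial : Fin n → Set
  Simplicial v = ∀ x y → InClosedNbhd v x → InClosedNbhd v y → x ≢ y → Adj G x y

  -- cut-vertex of a connected graph: G - v is disconnected, i.e. some two
  -- vertices other than v are joined by no walk avoiding v.
  CutVertex : Fin n → Set
  CutVertex v = ∃ λ a → ∃ λ b → a ≢ v × b ≢ v ×
                  (∀ k → ¬ Walk (λ x → x ≢ v) a b k)

  Dominating : Subset n → Set
  Dominating D = ∀ u → u ∉ D → ∃ λ w → w ∈ D × Adj G u w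

  InducedConnected : Subset n → Set
  InducedConnected D = ∀ a b → a ∈ D → b ∈ D → ∃ λ k → Walk (λ x → x ∈ D) a b k

  ConnectedDominating : Subset n → Set
  ConnectedDominating D = Dominating D × InducedConnected D

  -- a walk of length k from a to b is a shortest path iff no a–b walk in G is shorter
  WeaklyConvex : Subset n → Set
  WeaklyConvex D = ∀ a b → a ∈ D → b ∈ D →
    ∃ λ k → Walk (λ x → x ∈ D) a b k × (∀ j → Walk AnyVertex a b j → k ≤ j)

  WeaklyConvexDominating : Subset n → Set
  WeaklyConvexDominating D = Dominating D × WeaklyConvex D

  Minimum : (Subset n → Set) → Subset n → Set
  Minimum P D = P D × (∀ D' → P D' → ∣ D ∣ ≤ ∣ D' ∣)

-- A vertex outside a connected dominating set D separates nothing: every vertex is in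
-- or next to D and G[D] is connected, so any two other vertices are joined through D. So D - v is again connected (resp. weakly
-- convex) and dominating, contradicting minimality.
module Submission where

open import Defs
open import Data.Nat using (ℕ; suc; _≤_; z≤n; s≤s; _+_)
open import Data.Nat.Properties using (≤-trans; m≤n⇒m≤o+n; <⇒≱)
open import Data.Fin as Fin using (Fin; _≟_)
open import Data.Fin.Properties using (any?)
open import Data.Vec.Base using (_∷_; there)
open import Data.Fin.Subset using (Subset; _∈_; _∉_; _-_; ⁅_⁆)
open import Data.Fin.Subset.Properties
  using (_∈?_; p─q⊆p; x∈p∧x≢y⇒x∈p-y; x∈p⇒∣p-x∣<∣p∣)
open import Data.Product using (_×_; _,_; ∃; ∃-syntax; uncurry)
open import Data.Sum using (_⊎_; inj₁; inj₂)
open import Data.Empty using (⊥-elim)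
open import Function using (_∘_)
open import Relation.Nullary using (¬_; yes; no)
open import Relation.Nullary.Decidable using (_×-dec_; ¬?)
open import Relation.Binary.PropositionalEquality using (_≡_; _≢_; refl; subst)

x∉p-x : ∀ {n} (p : Subset n) (x : Fin n) → x ∉ p - x
x∉p-x (_ ∷ p) Fin.zero    ()
x∉p-x (_ ∷ p) (Fin.suc x) (there x∈p-x) = x∉p-x p x x∈p-x

x∈p-y⇒x≢y : ∀ {n} {p : Subset n} {x y : Fin n} → x ∈ p - y → x ≢ y
x∈p-y⇒x≢y {p = p} {x} x∈p-x refl = x∉p-x p x x∈p-x

module _ {n : ℕ} (G : Graph n) where

  private variable
    P Q : Fin n → Set
    a b c u v : Fin n
    j k : ℕ
    D : Subset n

  adj⇒≢ : Adj G u v → u ≢ v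
  adj⇒≢ uv refl = irrefl G uv

  mapWalk : (∀ {x} → P x → Q x) → Walk G P a b k → Walk G Q a b k
  mapWalk f [ pa ]            = [ f pa ]
  mapWalk f (pa ∷⟨ ab ⟩ rest) = f pa ∷⟨ ab ⟩ mapWalk f rest

  _++ʷ_ : Walk G P a b k → Walk G P b c j → Walk G P a c (k + j)
  [ _ ]             ++ʷ walk = walk
  (pa ∷⟨ ab ⟩ rest) ++ʷ walk = pa ∷⟨ ab ⟩ (rest ++ʷ walk)

  walk-start : Walk G P a b k → P a
  walk-start [ pa ]        = pa
  walk-start (pa ∷⟨ _ ⟩ _) = pa

  weaklyConvex⇒inducedConnected : WeaklyConvex G D → InducedConnected G D
  weaklyConvex⇒inducedConnected convex a b a∈D b∈D =
    let k , walk , _ = convex a b a∈D b∈D in k , walk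

  closedNbhd-sym : InClosedNbhd G a b → InClosedNbhd G b a
  closedNbhd-sym (inj₁ refl) = inj₁ refl
  closedNbhd-sym (inj₂ ab)   = inj₂ (sym G ab)

  closedNbhd-walk : P a → P b → InClosedNbhd G a b → ∃[ k ] Walk G P a b k
  closedNbhd-walk pa _  (inj₁ refl) = 0 , [ pa ]
  closedNbhd-walk pa pb (inj₂ ab)   = 1 , (pa ∷⟨ ab ⟩ [ pb ])

  closedNbhd-meets-dominating : Dominating G D → ∀ a → ∃ λ d → d ∈ D × InClosedNbhd G a d
  closedNbhd-meets-dominating {D = D} dom a with a ∈? D
  ... | yes a∈D = a , a∈D , inj₁ refl
  ... | no  a∉D = let d , d∈D , ad = dom a a∉D in d , d∈D , inj₂ ad

  dominating-walk : Dominating G D → InducedConnected G D → (∀ {x} → x ∈ D → P x) →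
                    P a → P b → ∃[ k ] Walk G P a b k
  dominating-walk {a = a} {b = b} dom conn D⊆P pa pb =
    let d , d∈D , ad = closedNbhd-meets-dominating dom a
        e , e∈D , be = closedNbhd-meets-dominating dom b
        _ , a→d = closedNbhd-walk pa (D⊆P d∈D) ad
        _ , d→e = conn d e d∈D e∈D
        _ , e→b = closedNbhd-walk (D⊆P e∈D) pb (closedNbhd-sym be)
    in _ , a→d ++ʷ (mapWalk D⊆P d→e ++ʷ e→b)

  cutVertex∈dominating : Dominating G D → InducedConnected G D → CutVertex G v → v ∈ D
  cutVertex∈dominating {D = D} {v = v} dom conn (a , b , a≢v , b≢v , separated) with v ∈? D
  ... | yes v∈D = v∈D
  ... | no  v∉D =
    let _ , walk = dominating-walk dom conn (λ { x∈D refl → v∉D x∈D }) a≢v b≢v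
    in ⊥-elim (separated _ walk)

  bypass-simplicial : Simplicial G v → a ≢ v → b ≢ v → Walk G P a b k →
                      ∃[ k′ ] k′ ≤ k × Walk G (λ x → P x × x ≢ v) a b k′
  bypass-simplicial s a≢v b≢v [ pa ] = 0 , z≤n , [ pa , a≢v ]
  bypass-simplicial {v = v} {a = a} s a≢v b≢v (_∷⟨_⟩_ {w = w} pa aw rest) with w ≟ v
  ... | no w≢v =
    let k′ , k′≤k , rest′ = bypass-simplicial s w≢v b≢v rest
    in suc k′ , s≤s k′≤k , ((pa , a≢v) ∷⟨ aw ⟩ rest′)
  ... | yes refl with rest
  ...   | [ _ ] = ⊥-elim (b≢v refl)
  ...   | _∷⟨_⟩_ {w = q} _ vq rest″ with bypass-simplicial s (adj⇒≢ (sym G vq)) b≢v rest″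
  ...     | k′ , k′≤k , rest′ with a ≟ q
  ...       | yes refl = k′ , m≤n⇒m≤o+n 2 k′≤k , rest′
  ...       | no  a≢q  =
    suc k′ , s≤s (m≤n⇒m≤o+n 1 k′≤k) ,
    ((pa , a≢v) ∷⟨ s a q (inj₂ (sym G aw)) (inj₂ vq) a≢q ⟩ rest′)

  bypass-simplicial-within : Simplicial G v → a ∈ D - v → b ∈ D - v → Walk G (_∈ D) a b k →
                             ∃[ k′ ] k′ ≤ k × Walk G (_∈ D - v) a b k′
  bypass-simplicial-within s a∈D-v b∈D-v walk =
    let k′ , k′≤k , walk′ = bypass-simplicial s (x∈p-y⇒x≢y a∈D-v) (x∈p-y⇒x≢y b∈D-v) walk
    in k′ , k′≤k , mapWalk (uncurry x∈p∧x≢y⇒x∈p-y) walk′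

  inducedConnected-remove-simplicial : Simplicial G v → InducedConnected G D →
                                       InducedConnected G (D - v)
  inducedConnected-remove-simplicial {v = v} {D = D} s conn a b a∈D-v b∈D-v =
    let _ , walk = conn a b (p─q⊆p D ⁅ v ⁆ a∈D-v) (p─q⊆p D ⁅ v ⁆ b∈D-v)
        k′ , _ , walk′ = bypass-simplicial-within s a∈D-v b∈D-v walk
    in k′ , walk′

  weaklyConvex-remove-simplicial : Simplicial G v → WeaklyConvex G D → WeaklyConvex G (D - v)
  weaklyConvex-remove-simplicial {v = v} {D = D} s convex a b a∈D-v b∈D-v =
    let _ , walk , shortest = convex a b (p─q⊆p D ⁅ v ⁆ a∈D-v) (p─q⊆p D ⁅ v ⁆ b∈D-v)
        k′ , k′≤k , walk′ = bypass-simplicial-within s a∈D-v b∈D-v walk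
    in k′ , walk′ , λ j walkʲ → ≤-trans k′≤k (shortest j walkʲ)

  closedNbhd-universal : Dominating G D → (∀ {u} → u ∈ D → u ≡ v) → ∀ x → InClosedNbhd G v x
  closedNbhd-universal {v = v} dom D⊆⁅v⁆ x with x ≟ v
  ... | yes x≡v = inj₁ x≡v
  ... | no  x≢v =
    let d , d∈D , xd = dom x (x≢v ∘ D⊆⁅v⁆)
    in inj₂ (sym G (subst (Adj G x) (D⊆⁅v⁆ d∈D) xd))

  simplicial-neighbour-in-dominating : ¬ Complete G → Simplicial G v → Dominating G D →
                                       InducedConnected G D → v ∈ D → ∃ λ u → u ∈ D - v × Adj G v u
  simplicial-neighbour-in-dominating {v = v} {D = D} ¬complete s dom conn v∈D
    with any? (λ u → (u ∈? D) ×-dec ¬? (u ≟ v))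
  ... | yes (u , u∈D , u≢v) with conn v u v∈D u∈D
  ...   | _ , [ _ ]           = ⊥-elim (u≢v refl)
  ...   | _ , (_ ∷⟨ vw ⟩ rest) = _ , x∈p∧x≢y⇒x∈p-y (walk-start rest) (adj⇒≢ (sym G vw)) , vw
  simplicial-neighbour-in-dominating {v = v} {D = D} ¬complete s dom conn v∈D | no ∄u =
    ⊥-elim (¬complete λ x y → s x y (universal x) (universal y))
    where
    only-v : ∀ {u} → u ∈ D → u ≡ v
    only-v {u} u∈D with u ≟ v
    ... | yes u≡v = u≡v
    ... | no  u≢v = ⊥-elim (∄u (u , u∈D , u≢v))

    universal : ∀ x → InClosedNbhd G v x
    universal = closedNbhd-universal dom only-v

  dominating-remove-simplicial : Simplicial G v → u ∈ D - v → Adj G v u → Dominating G D →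
                                 Dominating G (D - v)
  dominating-remove-simplicial {v = v} {u = u} s u∈D-v vu dom x x∉D-v with x ≟ v
  ... | yes refl = u , u∈D-v , vu
  ... | no  x≢v with dom x (λ x∈D → x∉D-v (x∈p∧x≢y⇒x∈p-y x∈D x≢v))
  ...   | w , w∈D , xw with w ≟ v
  ...     | no  w≢v = w , x∈p∧x≢y⇒x∈p-y w∈D w≢v , xw
  ...     | yes refl = u , u∈D-v , s x u (inj₂ (sym G xw)) (inj₂ vu) λ { refl → x∉D-v u∈D-v }

  connectedDominating-remove-simplicial : ¬ Complete G → Simplicial G v →
                                          ConnectedDominating G D → v ∈ D →
                                          ConnectedDominating G (D - v)
  connectedDominating-remove-simplicial ¬complete s (dom , conn) v∈D =
    let _ , u∈D-v , vu = simplicial-neighbour-in-dominating ¬complete s dom conn v∈D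
    in dominating-remove-simplicial s u∈D-v vu dom , inducedConnected-remove-simplicial s conn

  weaklyConvexDominating-remove-simplicial : ¬ Complete G → Simplicial G v →
                                             WeaklyConvexDominating G D → v ∈ D →
                                             WeaklyConvexDominating G (D - v)
  weaklyConvexDominating-remove-simplicial ¬complete s (dom , convex) v∈D =
    let conn = weaklyConvex⇒inducedConnected convex
        _ , u∈D-v , vu = simplicial-neighbour-in-dominating ¬complete s dom conn v∈D
    in dominating-remove-simplicial s u∈D-v vu dom , weaklyConvex-remove-simplicial s convex

  removable∉minimum : {Property : Subset n → Set} →
                      (Property D → v ∈ D → Property (D - v)) → Minimum G Property D → v ∉ D
  removable∉minimum {D = D} {v = v} closed (holds , minimal) v∈D =
    <⇒≱ (x∈p⇒∣p-x∣<∣p∣ v∈D) (minimal (D - v) (closed holds v∈D))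

mainTheorem4 : (n : ℕ) → 3 ≤ n → (G : Graph n) → Connected G → ¬ Complete G →
    (D : Subset n) →
    (Minimum G (ConnectedDominating G) D ⊎ Minimum G (WeaklyConvexDominating G) D) →
    (∀ v → CutVertex G v → v ∈ D) × (∀ v → Simplicial G v → v ∉ D)
mainTheorem4 _ _ G _ ¬complete D (inj₁ minimum@((dom , conn) , _)) =
    (λ _ → cutVertex∈dominating G dom conn)
  , (λ _ s → removable∉minimum G (connectedDominating-remove-simplicial G ¬complete s) minimum)
mainTheorem4 _ _ G _ ¬complete D (inj₂ minimum@((dom , convex) , _)) =
    (λ _ → cutVertex∈dominating G dom (weaklyConvex⇒inducedConnected G convex))
  , (λ _ s → removable∉minimum G (weaklyConvexDominating-remove-simplicial G ¬complete s) minimum)
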